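{- For every integer $m\geq 3$ there exists (for some $v$) a $3$-way $(v,3,1)$ Steiner trade of volume $m$ which is $1$-solely balanced.
   Context: Let $V$ be a set of $v$ elements and let $k,t$ be positive integers with $t<k<v$. A block is a $k$-subset of $V$. A $\mu$-way $(v,k,t)$ trade of volume $m$ is a family $T=\{T_1,\dots,T_\mu\}$ of $\mu$ pairwise disjoint collections of blocks, each $T_i$ consisting of exactly $m$ blocks, such that for every $t$-subset $S$ of $V$, the number of blocks of $T_i$ containing $S$ is the same for all $i$. It is a Steiner trade if every $t$-subset of $V$ is contained in at most one block of each $T_i$. A $\mu$-way $(v,k,t)$ Steiner trade is $t$-solely balanced if for all $1\le i<j\le\mu$, no $(t+1)$-subset of $V$ is contained both in a block of $T_i$ and in a block of $T_j$. -}

module Defs where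

open import Data.Nat using (ℕ; suc; _<_; _≤_)
open import Data.Fin using (Fin)
open import Data.Fin.Subset using (Subset; _⊆_; ∣_∣)
open import Data.Fin.Subset.Properties using (_⊆?_)
open import Data.List using (List; length; filter)
open import Data.List using () renaming (allFin to allFinL)
open import Data.Product using (Σ; _×_)
open import Function.Definitions using (Injective)
open import Relation.Binary.PropositionalEquality using (_≡_; _≢_)
open import Relation.Nullary using (¬_)

-- A μ-way (v,k,t) trade of volume m: μ collections T_i (i : Fin μ), each
-- consisting of exactly m (distinct) blocks blocks i 0, …, blocks i (m-1).
record Trade (μ v k t m : ℕ) : Set where
  field
    t<k       : t < k
    k<v       : k < v
    blocks    : Fin μ → Fin m → Subset v
    blockSize : ∀ i j → ∣ blocks i j ∣ ≡ k
    distinct  : ∀ i → Injective _≡_ _≡_ (blocks i)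
    disjoint  : ∀ i i' j j' → i ≢ i' → blocks i j ≢ blocks i' j'
  count : Fin μ → Subset v → ℕ
  count i S = length (filter (λ j → S ⊆? blocks i j) (allFinL m))
  field
    balanced  : ∀ (S : Subset v) → ∣ S ∣ ≡ t → ∀ i i' → count i S ≡ count i' S

open Trade public

Steiner : ∀ {μ v k t m} → Trade μ v k t m → Set
Steiner {μ} {v} {k} {t} {m} T =
  ∀ (i : Fin μ) (S : Subset v) → ∣ S ∣ ≡ t →
  ∀ (j j' : Fin m) → S ⊆ blocks T i j → S ⊆ blocks T i j' → j ≡ j'

SolelyBalanced : ∀ {μ v k t m} → Trade μ v k t m → Set
SolelyBalanced {μ} {v} {k} {t} {m} T =
  ∀ (i i' : Fin μ) → i ≢ i' → ∀ (P : Subset v) → ∣ P ∣ ≡ suc t →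
  ∀ (j j' : Fin m) → ¬ (P ⊆ blocks T i j × P ⊆ blocks T i' j')

-- Take three columns of m points each and the cyclic shift σ of a column.
-- For i = 0, 1, 2 the collection T_i consists of the m transversals
-- {(0, x), (1, σ^(i) x), (2, σ^(2i mod 3) x)}. Within one T_i the blocks are
-- pairwise disjoint and cover every point exactly once, which gives both
-- the Steiner property and balance on single points. Two blocks from
-- different collections that met in two columns c ≠ c' would force
-- σ^p y = σ^q y for cross sums p, q of the exponent table (c · i mod 3) with
-- 1 ≤ |p - q| ≤ 2; a cycle of length m ≥ 3 has no such periodic points.

module Submission where

open import Defs
open import Data.Nat using (ℕ; zero; suc; pred; _+_; _∸_; _*_; _%_; _≤_; z≤n; s≤s; ∣_-_∣; _≤?_)
open import Data.Nat.Properties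
  using (+-comm; ≤-total; ≤-trans; *-monoʳ-≤; <-irrefl; m+[n∸m]≡n; m≤n⇒∣m-n∣≡n∸m; ∣-∣-comm; m≢1+n+m; module ≤-Reasoning)
open import Data.Nat.GeneralisedArithmetic using (iterate)
open import Data.Fin using (Fin; zero; suc; toℕ; fromℕ; inject₁; _↑ˡ_; _↑ʳ_; combine; _≟_)
open import Data.Fin.Properties using (combine-surjective; toℕ-inject₁; 0≢1+n; suc-injective; all?)
open import Data.Fin.Relation.Unary.Top using (view; ‵fromℕ; ‵inject₁; view-fromℕ; view-inject₁)
open import Data.Fin.Permutation using (Permutation′; permutation; _⟨$⟩ʳ_; _⟨$⟩ˡ_; inverseʳ)
open import Data.Fin.Subset using (Subset; _∈_; _⊆_; ⁅_⁆; ⊥; ∣_∣; _∩_; inside; outside)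
open import Data.Fin.Subset.Properties
  using (_⊆?_; x∈⁅x⁆; x∈⁅y⁆⇒x≡y; x∈⁅y⁆⇔x≡y; x∈p∩q⁺; x∈p∩q⁻; ∣⁅x⁆∣≡1; nonempty?; Empty-unique; ∣⊥∣≡0; p⊆q⇒∣p∣≤∣q∣)
open import Data.Vec using ([]; _∷_; _++_)
open import Data.Vec.Properties using ([]=⇒lookup; lookup⇒[]=; lookup-++ˡ; lookup-++ʳ)
open import Data.List using ([]; _∷_; length; filter; tabulate)
open import Data.List using () renaming (allFin to allFinL)
open import Data.List.Properties using (filter-accept; filter-reject; filter-none)
open import Data.List.Relation.Unary.All.Properties using (tabulate⁺)
open import Data.Product using (Σ; ∃; _×_; _,_; map)
open import Data.Sum using (inj₁; inj₂)
open import Function using (_∘_; id; case_of_; _⇔_; mk⇔; Equivalence; Injection)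
import Function.Properties.Equivalence as ⇔
open import Function.Definitions using (Injective)
open import Function.Properties.Inverse using (↔⇒↣)
open import Relation.Binary.PropositionalEquality using (_≡_; _≢_; refl; sym; trans; cong; cong₂; subst; module ≡-Reasoning)
open import Relation.Nullary using (yes; no; ¬?; contradiction)
open import Relation.Nullary.Decidable using (from-yes; _→-dec_; _×-dec_)
open import Relation.Unary using (Pred; Decidable)

private variable
  m n : ℕ

∣p++q∣≡∣p∣+∣q∣ : (p : Subset m) (q : Subset n) → ∣ p ++ q ∣ ≡ ∣ p ∣ + ∣ q ∣
∣p++q∣≡∣p∣+∣q∣ []            q = refl
∣p++q∣≡∣p∣+∣q∣ (inside  ∷ p) q = cong suc (∣p++q∣≡∣p∣+∣q∣ p q)
∣p++q∣≡∣p∣+∣q∣ (outside ∷ p) q = ∣p++q∣≡∣p∣+∣q∣ p q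

∈-++ˡ : ∀ {i : Fin m} (p : Subset m) (q : Subset n) → i ↑ˡ n ∈ p ++ q ⇔ i ∈ p
∈-++ˡ {i = i} p q = mk⇔
  (λ h → lookup⇒[]= i p (trans (sym (lookup-++ˡ p q i)) ([]=⇒lookup h)))
  (λ h → lookup⇒[]= _ (p ++ q) (trans (lookup-++ˡ p q i) ([]=⇒lookup h)))

∈-++ʳ : ∀ {i : Fin n} (p : Subset m) (q : Subset n) → m ↑ʳ i ∈ p ++ q ⇔ i ∈ q
∈-++ʳ {i = i} p q = mk⇔
  (λ h → lookup⇒[]= i q (trans (sym (lookup-++ʳ p q i)) ([]=⇒lookup h)))
  (λ h → lookup⇒[]= _ (p ++ q) (trans (lookup-++ʳ p q i) ([]=⇒lookup h)))

∣p∣≡0⇒p≡⊥ : {p : Subset n} → ∣ p ∣ ≡ 0 → p ≡ ⊥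
∣p∣≡0⇒p≡⊥ {p = []}          _ = refl
∣p∣≡0⇒p≡⊥ {p = outside ∷ p} e = cong (outside ∷_) (∣p∣≡0⇒p≡⊥ e)

∣p∣≡1⇒p≡⁅x⁆ : {p : Subset n} → ∣ p ∣ ≡ 1 → ∃ λ x → p ≡ ⁅ x ⁆
∣p∣≡1⇒p≡⁅x⁆ {p = inside  ∷ p} e = zero , cong (inside ∷_) (∣p∣≡0⇒p≡⊥ (cong pred e))
∣p∣≡1⇒p≡⁅x⁆ {p = outside ∷ p} e with x , p≡⁅x⁆ ← ∣p∣≡1⇒p≡⁅x⁆ {p = p} e = suc x , cong (outside ∷_) p≡⁅x⁆

⁅x⁆⊆p⇔x∈p : ∀ {x : Fin n} {p} → ⁅ x ⁆ ⊆ p ⇔ x ∈ p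
⁅x⁆⊆p⇔x∈p {x = x} {p} = mk⇔ (λ ⊆p → ⊆p (x∈⁅x⁆ x))
  (λ x∈p {y} y∈⁅x⁆ → subst (_∈ p) (sym (x∈⁅y⁆⇒x≡y x y∈⁅x⁆)) x∈p)

subsingleton⇒∣p∣≤1 : ∀ {n} {p : Subset n} → (∀ {x y} → x ∈ p → y ∈ p → x ≡ y) → ∣ p ∣ ≤ 1
subsingleton⇒∣p∣≤1 {n} {p} unique with nonempty? p
... | yes (x , x∈p) = subst (∣ p ∣ ≤_) (∣⁅x⁆∣≡1 x)
  (p⊆q⇒∣p∣≤∣q∣ (λ y∈p → subst (_∈ ⁅ x ⁆) (unique x∈p y∈p) (x∈⁅x⁆ x)))
... | no  ∄x       = subst (_≤ 1) (sym (trans (cong ∣_∣ (Empty-unique ∄x)) (∣⊥∣≡0 n))) z≤n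

-- A point of Fin (n * m) is read as the pair (column c, position x) via combine c x.
transversal : (Fin n → Fin m) → Subset (n * m)
transversal {zero}  β = []
transversal {suc n} β = ⁅ β zero ⁆ ++ transversal (β ∘ suc)

∣transversal∣≡n : (β : Fin n → Fin m) → ∣ transversal β ∣ ≡ n
∣transversal∣≡n {zero}      β = refl
∣transversal∣≡n {suc n} {m} β = trans (∣p++q∣≡∣p∣+∣q∣ ⁅ β zero ⁆ _)
  (cong₂ _+_ (∣⁅x⁆∣≡1 (β zero)) (∣transversal∣≡n (β ∘ suc)))

combine∈transversal⇔ : ∀ (β : Fin n → Fin m) c {x} → combine c x ∈ transversal β ⇔ x ≡ β c
combine∈transversal⇔ {suc n} β zero    = ⇔.trans (∈-++ˡ ⁅ β zero ⁆ _) x∈⁅y⁆⇔x≡y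
combine∈transversal⇔ {suc n} β (suc c) = ⇔.trans (∈-++ʳ ⁅ β zero ⁆ _) (combine∈transversal⇔ (β ∘ suc) c)

transversal-injective : ∀ {β β' : Fin n → Fin m} → transversal β ≡ transversal β' → ∀ c → β c ≡ β' c
transversal-injective {β = β} {β'} eq c =
  Equivalence.to (combine∈transversal⇔ β' c)
    (subst (combine c (β c) ∈_) eq (Equivalence.from (combine∈transversal⇔ β c) refl))

∣transversal∩transversal∣≤1 : ∀ {β β' : Fin n → Fin m} →
  (∀ {c c'} → β c ≡ β' c → β c' ≡ β' c' → c ≡ c') → ∣ transversal β ∩ transversal β' ∣ ≤ 1
∣transversal∩transversal∣≤1 {n} {m} {β} {β'} agreeOnce = subsingleton⇒∣p∣≤1 unique
  where
  agreement : ∀ {c x} → combine c x ∈ transversal β ∩ transversal β' → x ≡ β c × x ≡ β' c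
  agreement {c} p∈ =
    map (Equivalence.to (combine∈transversal⇔ β c)) (Equivalence.to (combine∈transversal⇔ β' c))
      (x∈p∩q⁻ (transversal β) (transversal β') p∈)

  unique : ∀ {p q} → p ∈ transversal β ∩ transversal β' → q ∈ transversal β ∩ transversal β' → p ≡ q
  unique {p} {q} p∈ q∈
    with c , x , refl ← combine-surjective {n} {m} p | c' , x' , refl ← combine-surjective {n} {m} q
    with refl , βc≡β'c ← agreement p∈ | refl , βc'≡β'c' ← agreement q∈
    with refl ← agreeOnce βc≡β'c βc'≡β'c' = refl

⁅combine⁆⊆transversal⇔ : ∀ (β : Fin n → Fin m) c {x} → ⁅ combine c x ⁆ ⊆ transversal β ⇔ x ≡ β c
⁅combine⁆⊆transversal⇔ β c = ⇔.trans ⁅x⁆⊆p⇔x∈p (combine∈transversal⇔ β c)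

∣p∣≡1⇒p≡⁅combine⁆ : {p : Subset (n * m)} → ∣ p ∣ ≡ 1 → ∃ λ c → ∃ λ x → p ≡ ⁅ combine c x ⁆
∣p∣≡1⇒p≡⁅combine⁆ {n} {m} {p} ∣p∣≡1
  with y , refl ← ∣p∣≡1⇒p≡⁅x⁆ {p = p} ∣p∣≡1
  with c , x , refl ← combine-surjective {n} {m} y = c , x , refl

filter-tabulate-unique : ∀ {a p} {A : Set a} {P : Pred A p} (P? : Decidable P) (g : Fin n → A) {y} →
  P (g y) → (∀ {j} → P (g j) → j ≡ y) → filter P? (tabulate g) ≡ g y ∷ []
filter-tabulate-unique P? g {zero} Pgy unique =
  trans (filter-accept P? Pgy)
    (cong (g zero ∷_) (filter-none P? (tabulate⁺ {f = g ∘ suc} λ _ Pgj → 0≢1+n (sym (unique Pgj)))))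
filter-tabulate-unique P? g {suc y} Pgy unique =
  trans (filter-reject P? λ Pg0 → 0≢1+n (unique Pg0))
    (filter-tabulate-unique P? (g ∘ suc) Pgy (suc-injective ∘ unique))

NoCycleUpTo : ∀ {a} {A : Set a} → ℕ → (A → A) → Set a
NoCycleUpTo ℓ f = ∀ x {d} → 1 ≤ d → d ≤ ℓ → iterate f x d ≢ x

module _ {a} {A : Set a} (f : A → A) where

  iterate-+ : ∀ x p q → iterate f x (p + q) ≡ iterate f (iterate f x p) q
  iterate-+ x zero    q = refl
  iterate-+ x (suc p) q = iterate-+ (f x) p q

  iterate-commute : ∀ x p → iterate f (f x) p ≡ f (iterate f x p)
  iterate-commute x zero    = refl
  iterate-commute x (suc p) = iterate-commute (f x) p

  iterate-injective : Injective _≡_ _≡_ f → ∀ {x y} p → iterate f x p ≡ iterate f y p → x ≡ y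
  iterate-injective f-inj zero    eq = eq
  iterate-injective f-inj (suc p) eq = f-inj (iterate-injective f-inj p eq)

  iterate-inverse : ∀ {g} → (∀ x → f (g x) ≡ x) → ∀ x p → iterate f (iterate g x p) p ≡ x
  iterate-inverse     f∘g x zero    = refl
  iterate-inverse {g} f∘g x (suc p) = begin
    iterate f (f (iterate g (g x) p)) p ≡⟨ iterate-commute (iterate g (g x) p) p ⟩
    f (iterate f (iterate g (g x) p) p) ≡⟨ cong f (iterate-inverse f∘g (g x) p) ⟩
    f (g x)                             ≡⟨ f∘g x ⟩
    x                                   ∎
    where open ≡-Reasoning

  iterate-cross : ∀ {x y} p p' q q' → iterate f x p ≡ iterate f y p' → iterate f x q ≡ iterate f y q' →
    iterate f y (p' + q) ≡ iterate f y (q' + p)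
  iterate-cross {x} {y} p p' q q' eq eq' = begin
    iterate f y (p' + q)           ≡⟨ iterate-+ y p' q ⟩
    iterate f (iterate f y p') q   ≡⟨ cong (λ z → iterate f z q) eq ⟨
    iterate f (iterate f x p) q    ≡⟨ iterate-+ x p q ⟨
    iterate f x (p + q)            ≡⟨ cong (iterate f x) (+-comm p q) ⟩
    iterate f x (q + p)            ≡⟨ iterate-+ x q p ⟩
    iterate f (iterate f x q) p    ≡⟨ cong (λ z → iterate f z p) eq' ⟩
    iterate f (iterate f y q') p   ≡⟨ iterate-+ y q' p ⟨
    iterate f y (q' + p)           ∎
    where open ≡-Reasoning

  iterate-separated-≤ : ∀ {ℓ} → NoCycleUpTo ℓ f → ∀ y {p q} → p ≤ q → 1 ≤ q ∸ p → q ∸ p ≤ ℓ →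
    iterate f y p ≢ iterate f y q
  iterate-separated-≤ noCycle y {p} {q} p≤q 1≤q∸p q∸p≤ℓ eq =
    noCycle (iterate f y p) 1≤q∸p q∸p≤ℓ (begin
    iterate f (iterate f y p) (q ∸ p) ≡⟨ iterate-+ y p (q ∸ p) ⟨
    iterate f y (p + (q ∸ p))         ≡⟨ cong (iterate f y) (m+[n∸m]≡n p≤q) ⟩
    iterate f y q                     ≡⟨ eq ⟨
    iterate f y p                     ∎)
    where open ≡-Reasoning

  iterate-separated : ∀ {ℓ} → NoCycleUpTo ℓ f → ∀ y p q → 1 ≤ ∣ p - q ∣ → ∣ p - q ∣ ≤ ℓ →
    iterate f y p ≢ iterate f y q
  iterate-separated {ℓ} noCycle y p q 1≤∣p-q∣ ∣p-q∣≤ℓ with ≤-total p q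
  ... | inj₁ p≤q = iterate-separated-≤ noCycle y p≤q
    (subst (1 ≤_) (m≤n⇒∣m-n∣≡n∸m p≤q) 1≤∣p-q∣) (subst (_≤ ℓ) (m≤n⇒∣m-n∣≡n∸m p≤q) ∣p-q∣≤ℓ)
  ... | inj₂ q≤p = iterate-separated-≤ noCycle y q≤p
    (subst (1 ≤_) ∣p-q∣≡p∸q 1≤∣p-q∣) (subst (_≤ ℓ) ∣p-q∣≡p∸q ∣p-q∣≤ℓ) ∘ sym
    where ∣p-q∣≡p∸q = trans (∣-∣-comm p q) (m≤n⇒∣m-n∣≡n∸m q≤p)

rotate : Fin (suc n) → Fin (suc n)
rotate zero    = fromℕ _
rotate (suc i) = inject₁ i

rotate⁻¹ : Fin (suc n) → Fin (suc n)
rotate⁻¹ i with view i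
... | ‵fromℕ     = zero
... | ‵inject₁ j = suc j

rotate∘rotate⁻¹ : ∀ (i : Fin (suc n)) → rotate (rotate⁻¹ i) ≡ i
rotate∘rotate⁻¹ i with view i
... | ‵fromℕ     = refl
... | ‵inject₁ j = refl

rotate⁻¹∘rotate : ∀ (i : Fin (suc n)) → rotate⁻¹ (rotate i) ≡ i
rotate⁻¹∘rotate {n} zero rewrite view-fromℕ n = refl
rotate⁻¹∘rotate (suc i) rewrite view-inject₁ i = refl

rotation : Permutation′ (suc n)
rotation = permutation rotate rotate⁻¹ rotate∘rotate⁻¹ rotate⁻¹∘rotate

rotate-noCycleUpTo2 : ∀ {k} → NoCycleUpTo 2 (rotate {2 + k})
rotate-noCycleUpTo2 _             {0}               ()  _
rotate-noCycleUpTo2 zero          {1}               _   _ ()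
rotate-noCycleUpTo2 (suc i)       {1}               _   _ eq =
  m≢1+n+m (toℕ i) {0} (trans (sym (toℕ-inject₁ i)) (cong toℕ eq))
rotate-noCycleUpTo2 zero          {2}               _   _ ()
rotate-noCycleUpTo2 (suc zero)    {2}               _   _ ()
rotate-noCycleUpTo2 (suc (suc i)) {2}               _   _ eq =
  m≢1+n+m (toℕ i) {1} (trans (sym (trans (toℕ-inject₁ (inject₁ i)) (toℕ-inject₁ i))) (cong toℕ eq))
rotate-noCycleUpTo2 _             {suc (suc (suc _))} _ (s≤s (s≤s ()))

exponent : Fin 3 → Fin 3 → ℕ
exponent c i = (toℕ c * toℕ i) % 3

crossGap : Fin 3 → Fin 3 → Fin 3 → Fin 3 → ℕ
crossGap c c' i i' = ∣ (exponent c i' + exponent c' i) - (exponent c' i' + exponent c i) ∣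

exponent-crossGap : ∀ c c' i i' → c ≢ c' → i ≢ i' → 1 ≤ crossGap c c' i i' × crossGap c c' i i' ≤ 2
exponent-crossGap = from-yes (all? λ c → all? λ c' → all? λ i → all? λ i' →
  ¬? (c ≟ c') →-dec ¬? (i ≟ i') →-dec (1 ≤? crossGap c c' i i') ×-dec (crossGap c c' i i' ≤? 2))

module TripleTrade {m} (2≤m : 2 ≤ m) (σ : Permutation′ m) (noCycle : NoCycleUpTo 2 (σ ⟨$⟩ʳ_)) where

  σ-injective : ∀ {x y} → σ ⟨$⟩ʳ x ≡ σ ⟨$⟩ʳ y → x ≡ y
  σ-injective = Injection.injective (↔⇒↣ σ)

  coord : Fin 3 → Fin m → Fin 3 → Fin m
  coord i j c = iterate (σ ⟨$⟩ʳ_) j (exponent c i)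

  coord-injective : ∀ i c {j j'} → coord i j c ≡ coord i j' c → j ≡ j'
  coord-injective i c = iterate-injective _ σ-injective (exponent c i)

  coord-agreesOnce : ∀ {i i'} → i ≢ i' → ∀ j j' {c c'} →
    coord i j c ≡ coord i' j' c → coord i j c' ≡ coord i' j' c' → c ≡ c'
  coord-agreesOnce {i} {i'} i≢i' j j' {c} {c'} eq eq' with c ≟ c'
  ... | yes c≡c' = c≡c'
  ... | no  c≢c' with gap≥1 , gap≤2 ← exponent-crossGap c c' i i' c≢c' i≢i' =
    contradiction (iterate-cross _ (exponent c i) (exponent c i') (exponent c' i) (exponent c' i') eq eq')
      (iterate-separated _ noCycle j' (exponent c i' + exponent c' i) (exponent c' i' + exponent c i)
        gap≥1 gap≤2)

  block : Fin 3 → Fin m → Subset (3 * m)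
  block i j = transversal (coord i j)

  block≡⇒coord≡ : ∀ i j i' j' → block i j ≡ block i' j' → ∀ c → coord i j c ≡ coord i' j' c
  block≡⇒coord≡ i j i' j' = transversal-injective {β = coord i j} {β' = coord i' j'}

  coord-surjective : ∀ i c x → coord i (iterate (σ ⟨$⟩ˡ_) x (exponent c i)) c ≡ x
  coord-surjective i c x = iterate-inverse _ (λ _ → inverseʳ σ) x (exponent c i)

  ⁅combine⁆⊆block⇔ : ∀ i j c {x} → ⁅ combine c x ⁆ ⊆ block i j ⇔ x ≡ coord i j c
  ⁅combine⁆⊆block⇔ i j = ⁅combine⁆⊆transversal⇔ (coord i j)

  count-singleton : ∀ i {S} → ∣ S ∣ ≡ 1 → length (filter (λ j → S ⊆? block i j) (allFinL m)) ≡ 1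
  count-singleton i {S} ∣S∣≡1 with c , x , refl ← ∣p∣≡1⇒p≡⁅combine⁆ {3} {m} {S} ∣S∣≡1 =
    cong length (filter-tabulate-unique (λ j → ⁅ combine c x ⁆ ⊆? block i j) id
      (Equivalence.from (⁅combine⁆⊆block⇔ i _ c) (sym (coord-surjective i c x)))
      (λ {j} S⊆ → coord-injective i c
        (trans (sym (Equivalence.to (⁅combine⁆⊆block⇔ i j c) S⊆)) (sym (coord-surjective i c x)))))

  trade : Trade 3 (3 * m) 3 1 m
  trade = record
    { t<k       = s≤s (s≤s z≤n)
    ; k<v       = ≤-trans (s≤s (s≤s (s≤s (s≤s z≤n)))) (*-monoʳ-≤ 3 2≤m)
    ; blocks    = block
    ; blockSize = λ i j → ∣transversal∣≡n (coord i j)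
    ; distinct  = λ i {j} {j'} eq → coord-injective i zero (block≡⇒coord≡ i j i j' eq zero)
    ; disjoint  = λ i i' j j' i≢i' eq →
        case coord-agreesOnce i≢i' j j' {zero} {suc zero}
               (block≡⇒coord≡ i j i' j' eq zero) (block≡⇒coord≡ i j i' j' eq (suc zero)) of λ ()
    ; balanced  = λ S ∣S∣≡1 i i' → trans (count-singleton i ∣S∣≡1) (sym (count-singleton i' ∣S∣≡1))
    }

  steiner : Steiner trade
  steiner i S ∣S∣≡1 j j' S⊆ S⊆' with c , x , refl ← ∣p∣≡1⇒p≡⁅combine⁆ {3} {m} {S} ∣S∣≡1 =
    coord-injective i c
      (trans (sym (Equivalence.to (⁅combine⁆⊆block⇔ i j c) S⊆)) (Equivalence.to (⁅combine⁆⊆block⇔ i j' c) S⊆'))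

  solelyBalanced : SolelyBalanced trade
  solelyBalanced i i' i≢i' P ∣P∣≡2 j j' (P⊆ , P⊆') = <-irrefl refl (begin
    2                                  ≡⟨ ∣P∣≡2 ⟨
    ∣ P ∣                              ≤⟨ p⊆q⇒∣p∣≤∣q∣ (λ x∈P → x∈p∩q⁺ (P⊆ x∈P , P⊆' x∈P)) ⟩
    ∣ block i j ∩ block i' j' ∣        ≤⟨ ∣transversal∩transversal∣≤1 (coord-agreesOnce i≢i' j j') ⟩
    1                                  ∎)
    where open ≤-Reasoning

theorem3p8 : (m : ℕ) → 3 ≤ m →
    Σ ℕ (λ v → Σ (Trade 3 v 3 1 m) (λ T → Steiner T × SolelyBalanced T))
theorem3p8 (suc (suc (suc k))) (s≤s (s≤s (s≤s _))) = _ , trade , steiner , solelyBalanced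
  where open TripleTrade (s≤s (s≤s z≤n)) rotation rotate-noCycleUpTo2
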